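{- Let $\le_r$ be the relation obtained from the rules defining $\le$ by replacing the rule (conv) by the rule (red): from $T\to^*T'$, $T'\le U'$ and $U\to^* U'$ infer $T\le U$. Then $\le_r$ equals $\le$.
   Context: Sorts: $\mathcal S=\{\star,\Box\}$. Let $\mathcal X$ be a set of variables and $\mathcal F$ a set of symbols; a set $\mathcal R$ of rewrite rules is given, a symbol is defined if it heads the left-hand side of some rule and constant otherwise; $\mathcal{CF}^\Box$ denotes the constant symbols of sort $\Box$. Size expressions form a first-order term algebra $\mathcal A$ over size symbols and size variables, with a quasi-ordering $\le_{\mathcal A}$. Terms: $t::= s\mid x\mid C^a\mid f\mid [x:t]t\mid (x:t)t\mid tt$ with $s\in\mathcal S$, $C\in\mathcal{CF}^\Box$, $a\in\mathcal A$, $f\in\mathcal F\setminus\mathcal{CF}^\Box$. The reduction $\to$ is $\beta\cup\mathcal R$ closed under contexts and is assumed confluent; $\to^*$ is its reflexive-transitive closure and $T\downarrow U$ means $T$ and $U$ have a common reduct. Subtyping $\le$ is the smallest relation closed under: (refl) $T\le T$; (size) $C^a\vec t\le C^b\vec t$ when $C\in\mathcal{CF}^\Box$ and $a\le_{\mathcal A}b$; (prod) from $U'\le U$ and $V\le V'$ infer $(x:U)V\le(x:U')V'$; (conv) from $T'\le U'$, $T\downarrow T'$, $U'\downarrow U$ infer $T\le U$; (trans) from $T\le U$, $U\le V$ infer $T\le V$. -}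

module Defs where

open import Data.Nat using (ℕ; zero; suc)
open import Data.List using (List; []; _∷_)
open import Data.Product using (Σ; ∃; _×_; _,_)
open import Data.Unit using (⊤)
open import Relation.Nullary using (¬_)
open import Relation.Binary.PropositionalEquality using (_≡_)
open import Relation.Binary.Structures using (IsPreorder)
open import Relation.Binary.Construct.Closure.ReflexiveTransitive using (Star)

data Sort : Set where
  star box : Sort

-- Raw terms, de Bruijn indices for the variables of 𝒳.
--   t ::= s | x | C^a | f | [x:t]t | (x:t)t | t t
-- (the side conditions C ∈ 𝒞ℱ^□ for sized symbols and f ∉ 𝒞ℱ^□ for plain
--  symbols depend on the rules, so they are imposed by the predicate WF below)
data Raw (Sym Size : Set) : Set where
  srt  : Sort → Raw Sym Size
  var  : ℕ → Raw Sym Size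
  size : Sym → Size → Raw Sym Size
  sym  : Sym → Raw Sym Size
  lam  : Raw Sym Size → Raw Sym Size → Raw Sym Size
  pi   : Raw Sym Size → Raw Sym Size → Raw Sym Size
  app  : Raw Sym Size → Raw Sym Size → Raw Sym Size

module _ {Sym Size : Set} where

  apps : Raw Sym Size → List (Raw Sym Size) → Raw Sym Size
  apps t []       = t
  apps t (u ∷ us) = apps (app t u) us

  head : Raw Sym Size → Raw Sym Size
  head (app t u) = head t
  head t         = t

  ext : (ℕ → ℕ) → ℕ → ℕ
  ext ρ zero    = zero
  ext ρ (suc n) = suc (ρ n)

  rename : (ℕ → ℕ) → Raw Sym Size → Raw Sym Size
  rename ρ (srt s)    = srt s
  rename ρ (var n)    = var (ρ n)
  rename ρ (size C a) = size C a
  rename ρ (sym f)    = sym f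
  rename ρ (lam T t)  = lam (rename ρ T) (rename (ext ρ) t)
  rename ρ (pi T U)   = pi (rename ρ T) (rename (ext ρ) U)
  rename ρ (app t u)  = app (rename ρ t) (rename ρ u)

  exts : (ℕ → Raw Sym Size) → ℕ → Raw Sym Size
  exts σ zero    = var zero
  exts σ (suc n) = rename suc (σ n)

  subst : (ℕ → Raw Sym Size) → Raw Sym Size → Raw Sym Size
  subst σ (srt s)    = srt s
  subst σ (var n)    = σ n
  subst σ (size C a) = size C a
  subst σ (sym f)    = sym f
  subst σ (lam T t)  = lam (subst σ T) (subst (exts σ) t)
  subst σ (pi T U)   = pi (subst σ T) (subst (exts σ) U)
  subst σ (app t u)  = app (subst σ t) (subst σ u)

  subst₀ : Raw Sym Size → ℕ → Raw Sym Size
  subst₀ u zero    = u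
  subst₀ u (suc n) = var n

  _[_] : Raw Sym Size → Raw Sym Size → Raw Sym Size
  t [ u ] = subst (subst₀ u) t

record Setting : Set₁ where
  field
    Sym      : Set
    sortOf   : Sym → Sort
    Size     : Set
    _≤A_     : Size → Size → Set
    ≤A-quasi : IsPreorder _≡_ _≤A_
    Rule     : Set
    lhs      : Rule → Raw Sym Size
    rhs      : Rule → Raw Sym Size
    lhs-headed : ∀ r → Σ Sym λ f → head (lhs r) ≡ sym f

module Over (S : Setting) where
  open Setting S

  Term : Set
  Term = Raw Sym Size

  Defined : Sym → Set
  Defined f = Σ Rule λ r → head (lhs r) ≡ sym f

  Constant : Sym → Set
  Constant f = ¬ Defined f

  CF□ : Sym → Set
  CF□ C = Constant C × sortOf C ≡ box

  WF : Term → Set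
  WF (srt s)    = ⊤
  WF (var n)    = ⊤
  WF (size C a) = CF□ C
  WF (sym f)    = ¬ CF□ f
  WF (lam T t)  = WF T × WF t
  WF (pi T U)   = WF T × WF U
  WF (app t u)  = WF t × WF u

  WFSubst : (ℕ → Term) → Set
  WFSubst σ = ∀ n → WF (σ n)

  RulesWF : Set
  RulesWF = ∀ r → WF (lhs r) × WF (rhs r)

  infix 4 _⟶_ _⟶*_ _↓_
  data _⟶_ : Term → Term → Set where
    beta  : ∀ {T t u} → app (lam T t) u ⟶ t [ u ]
    rule  : ∀ r (σ : ℕ → Term) → WFSubst σ → subst σ (lhs r) ⟶ subst σ (rhs r)
    lam₁  : ∀ {T T' t} → T ⟶ T' → lam T t ⟶ lam T' t
    lam₂  : ∀ {T t t'} → t ⟶ t' → lam T t ⟶ lam T t'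
    pi₁   : ∀ {T T' U} → T ⟶ T' → pi T U ⟶ pi T' U
    pi₂   : ∀ {T U U'} → U ⟶ U' → pi T U ⟶ pi T U'
    app₁  : ∀ {t t' u} → t ⟶ t' → app t u ⟶ app t' u
    app₂  : ∀ {t u u'} → u ⟶ u' → app t u ⟶ app t u'

  _⟶*_ : Term → Term → Set
  _⟶*_ = Star _⟶_

  _↓_ : Term → Term → Set
  T ↓ U = ∃ λ V → T ⟶* V × U ⟶* V

  Confluent : Set
  Confluent = ∀ {t u v} → WF t → t ⟶* u → t ⟶* v → u ↓ v

  infix 4 _≤_ _≤r_
  data _≤_ : Term → Term → Set where
    refl≤  : ∀ {T} → T ≤ T
    size≤  : ∀ {C a b ts} → CF□ C → a ≤A b → apps (size C a) ts ≤ apps (size C b) ts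
    prod≤  : ∀ {U U' V V'} → U' ≤ U → V ≤ V' → pi U V ≤ pi U' V'
    conv≤  : ∀ {T T' U U'} → WF T' → WF U' → T' ≤ U' → T ↓ T' → U' ↓ U → T ≤ U
    trans≤ : ∀ {T U V} → WF U → T ≤ U → U ≤ V → T ≤ V

  data _≤r_ : Term → Term → Set where
    refl≤  : ∀ {T} → T ≤r T
    size≤  : ∀ {C a b ts} → CF□ C → a ≤A b → apps (size C a) ts ≤r apps (size C b) ts
    prod≤  : ∀ {U U' V V'} → U' ≤r U → V ≤r V' → pi U V ≤r pi U' V'
    red≤   : ∀ {T T' U U'} → WF T' → WF U' → T ⟶* T' → T' ≤r U' → U ⟶* U' → T ≤r U
    trans≤ : ∀ {T U V} → WF U → T ≤r U → U ≤r V → T ≤r V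

-- (conv) is simulated by (red) and transitivity: if T ↓ T' through V, then
-- T ⟶* V, V ≤r V and T' ⟶* V give T ≤r T' by (red), and the (conv) instance
-- T ≤ U becomes the chain T ≤r T' ≤r U' ≤r U. The side conditions of (trans)
-- and (red) ask for well-formed middle terms; these are reducts of well-formed
-- terms, and reduction preserves well-formedness because the rules consist of
-- well-formed terms.
module Submission where

open import Defs
open import Data.Nat using (ℕ; zero; suc)
open import Data.Product using (_×_; _,_; proj₂)
open import Data.Unit using (tt)
open import Relation.Binary.Construct.Closure.ReflexiveTransitive using (ε; _◅_)

module WellFormedness (S : Setting) where
  open Setting S
  open Over S

  wf-rename : ∀ (ρ : ℕ → ℕ) t → WF t → WF (rename ρ t)
  wf-rename ρ (srt s)    w       = w
  wf-rename ρ (var n)    w       = w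
  wf-rename ρ (size C a) w       = w
  wf-rename ρ (sym f)    w       = w
  wf-rename ρ (lam T t)  (u , v) = wf-rename ρ T u , wf-rename (ext {Sym} {Size} ρ) t v
  wf-rename ρ (pi T U)   (u , v) = wf-rename ρ T u , wf-rename (ext {Sym} {Size} ρ) U v
  wf-rename ρ (app t t') (u , v) = wf-rename ρ t u , wf-rename ρ t' v

  wf-exts : ∀ {σ} → WFSubst σ → WFSubst (exts σ)
  wf-exts     wσ zero    = tt
  wf-exts {σ} wσ (suc n) = wf-rename suc (σ n) (wσ n)

  wf-subst : ∀ {σ} → WFSubst σ → ∀ t → WF t → WF (subst σ t)
  wf-subst wσ (srt s)    w       = w
  wf-subst wσ (var n)    w       = wσ n
  wf-subst wσ (size C a) w       = w
  wf-subst wσ (sym f)    w       = w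
  wf-subst wσ (lam T t)  (u , v) = wf-subst wσ T u , wf-subst (wf-exts wσ) t v
  wf-subst wσ (pi T U)   (u , v) = wf-subst wσ T u , wf-subst (wf-exts wσ) U v
  wf-subst wσ (app t t') (u , v) = wf-subst wσ t u , wf-subst wσ t' v

  wf-subst₀ : ∀ {u} → WF u → WFSubst (subst₀ u)
  wf-subst₀ wu zero    = wu
  wf-subst₀ wu (suc n) = tt

  module _ (rulesWF : RulesWF) where

    ⟶-preserves-WF : ∀ {t u} → WF t → t ⟶ u → WF u
    ⟶-preserves-WF ((_ , wt) , wu) (beta {t = t}) = wf-subst (wf-subst₀ wu) t wt
    ⟶-preserves-WF _ (rule r σ wσ) = wf-subst wσ (rhs r) (proj₂ (rulesWF r))
    ⟶-preserves-WF (u , v) (lam₁ s) = ⟶-preserves-WF u s , v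
    ⟶-preserves-WF (u , v) (lam₂ s) = u , ⟶-preserves-WF v s
    ⟶-preserves-WF (u , v) (pi₁ s)  = ⟶-preserves-WF u s , v
    ⟶-preserves-WF (u , v) (pi₂ s)  = u , ⟶-preserves-WF v s
    ⟶-preserves-WF (u , v) (app₁ s) = ⟶-preserves-WF u s , v
    ⟶-preserves-WF (u , v) (app₂ s) = u , ⟶-preserves-WF v s

    ⟶*-preserves-WF : ∀ {t u} → WF t → t ⟶* u → WF u
    ⟶*-preserves-WF w ε        = w
    ⟶*-preserves-WF w (s ◅ ss) = ⟶*-preserves-WF (⟶-preserves-WF w s) ss

module Subtyping (S : Setting) where
  open Over S
  open WellFormedness S

  ≤r⇒≤ : ∀ {T U} → T ≤r U → T ≤ U
  ≤r⇒≤ refl≤                   = refl≤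
  ≤r⇒≤ (size≤ {ts = ts} C a≤b) = size≤ {ts = ts} C a≤b
  ≤r⇒≤ (prod≤ U'≤U V≤V')       = prod≤ (≤r⇒≤ U'≤U) (≤r⇒≤ V≤V')
  ≤r⇒≤ (red≤ {T' = T'} {U' = U'} wT' wU' T⟶*T' T'≤U' U⟶*U') =
    conv≤ wT' wU' (≤r⇒≤ T'≤U') (T' , T⟶*T' , ε) (U' , ε , U⟶*U')
  ≤r⇒≤ (trans≤ wU T≤U U≤V)     = trans≤ wU (≤r⇒≤ T≤U) (≤r⇒≤ U≤V)

  module _ (rulesWF : RulesWF) where

    ↓⇒≤r : ∀ {T U} → WF T → T ↓ U → T ≤r U
    ↓⇒≤r wT (V , T⟶*V , U⟶*V) = red≤ wV wV T⟶*V refl≤ U⟶*V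
      where wV = ⟶*-preserves-WF rulesWF wT T⟶*V

    ≤⇒≤r : ∀ {T U} → WF T → WF U → T ≤ U → T ≤r U
    ≤⇒≤r _ _ refl≤                   = refl≤
    ≤⇒≤r _ _ (size≤ {ts = ts} C a≤b) = size≤ {ts = ts} C a≤b
    ≤⇒≤r (wU , wV) (wU' , wV') (prod≤ U'≤U V≤V') =
      prod≤ (≤⇒≤r wU' wU U'≤U) (≤⇒≤r wV wV' V≤V')
    ≤⇒≤r wT _ (conv≤ wT' wU' T'≤U' T↓T' U'↓U) =
      trans≤ wT' (↓⇒≤r wT T↓T') (trans≤ wU' (≤⇒≤r wT' wU' T'≤U') (↓⇒≤r wU' U'↓U))
    ≤⇒≤r wT wV (trans≤ wU T≤U U≤V) = trans≤ wU (≤⇒≤r wT wU T≤U) (≤⇒≤r wU wV U≤V)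

mainTheorem4 : (S : Setting) → let open Over S in
    Confluent → RulesWF →
    ∀ T U → WF T → WF U → (T ≤r U → T ≤ U) × (T ≤ U → T ≤r U)
mainTheorem4 S _ rulesWF T U wT wU = ≤r⇒≤ , ≤⇒≤r rulesWF wT wU
  where open Subtyping S
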